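{- Let $\langle R,\circ,e,-,\infty\rangle$ be a CBI-model. Then for all $X,Y,Z\subseteq R$: (1) $X\circ Y=Y\circ X$, $X\circ(Y\circ Z)=(X\circ Y)\circ Z$ and $\{e\}\circ X=X$; (2) $-X = X \mathbin{ -\bullet} \{\infty\}$; (3) $-(-X)=X$; where $X\mathbin{ -\bullet} Y = \{z\in R \mid \exists x\in X, y\in Y.\ y\in x\circ z\}$.
   Context: A BBI-model is $\langle R,\circ,e\rangle$ with $e\in R$, $\circ:R\times R\to\mathcal{P}(R)$ commutative and associative (w.r.t. the pointwise extension $X\circ Y=\bigcup_{x\in X,y\in Y}x\circ y$ to subsets), and $r\circ e=\{r\}$ for all $r$. A CBI-model is $\langle R,\circ,e,-,\infty\rangle$ with $\langle R,\circ,e\rangle$ a BBI-model, $-:R\to R$, $\infty\in R$, such that for each $x\in R$, $-x$ is the unique element with $\infty\in x\circ(-x)$. The map $-$ is extended pointwise to subsets: $-X=\{ -x\mid x\in X\}$. -}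

module Defs where

open import Level using (Level; _⊔_; suc)
open import Data.Product using (Σ; ∃; _×_; _,_)
open import Relation.Binary.PropositionalEquality using (_≡_)

Subset : ∀ {ℓ} → Set ℓ → Set (suc ℓ)
Subset {ℓ} R = R → Set ℓ

⟦_⟧ : ∀ {ℓ} {R : Set ℓ} → R → Subset R
⟦ r ⟧ = λ z → z ≡ r

_⊆_ : ∀ {ℓ} {R : Set ℓ} → Subset R → Subset R → Set ℓ
X ⊆ Y = ∀ z → X z → Y z

_≐_ : ∀ {ℓ} {R : Set ℓ} → Subset R → Subset R → Set ℓ
X ≐ Y = (X ⊆ Y) × (Y ⊆ X)

lift : ∀ {ℓ} {R : Set ℓ} → (R → R → Subset R) → Subset R → Subset R → Subset R
lift _∘_ X Y z = Σ _ λ x → Σ _ λ y → X x × Y y × (x ∘ y) z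

image : ∀ {ℓ} {R : Set ℓ} → (R → R) → Subset R → Subset R
image f X z = Σ _ λ x → X x × z ≡ f x

wand : ∀ {ℓ} {R : Set ℓ} → (R → R → Subset R) → Subset R → Subset R → Subset R
wand _∘_ X Y z = Σ _ λ x → Σ _ λ y → X x × Y y × (x ∘ z) y

record BBIModel (ℓ : Level) : Set (suc ℓ) where
  field
    R    : Set ℓ
    _∘_  : R → R → Subset R
    e    : R
    comm  : ∀ x y → (x ∘ y) ≐ (y ∘ x)
    assoc : ∀ x y z →
      lift _∘_ ⟦ x ⟧ (y ∘ z) ≐ lift _∘_ (x ∘ y) ⟦ z ⟧
    unit  : ∀ r → (r ∘ e) ≐ ⟦ r ⟧

record CBIModel (ℓ : Level) : Set (suc ℓ) where
  field
    bbi : BBIModel ℓ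
  open BBIModel bbi public
  field
    -_  : R → R
    ∞   : R
    inv-mem : ∀ x → (x ∘ (- x)) ∞
    inv-unique : ∀ x y → (x ∘ y) ∞ → y ≡ - x

module Submission where

-- The structural laws (1) only use the BBI axioms, so they are
-- proved for an arbitrary BBI-model: commutativity and associativity lift
-- from elements to subsets because the pointwise extension is a union over
-- witnesses, and {e} ∘ X = X follows from the left unit law e ∘ r = {r}.  Part (2) is the definition of
-- -x read through the wand: z ∈ X -• {∞} says ∞ ∈ x ∘ z for some x ∈ X,
-- and uniqueness of the inverse forces z = -x.  Part (3) reduces to the
-- involution law -(-x) = x, which again follows from uniqueness since
-- ∞ ∈ (-x) ∘ x by commutativity.

open import Defs
open import Data.Product using (_×_; _,_; proj₁; proj₂)
open import Relation.Binary.PropositionalEquality using (_≡_; refl; sym; subst)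

module BBILaws {ℓ} (M : BBIModel ℓ) where
  open BBIModel M

  unitˡ : ∀ r → (e ∘ r) ≐ ⟦ r ⟧
  unitˡ r = (λ z m → proj₁ (unit r) z (proj₁ (comm e r) z m))
          , (λ z m → proj₁ (comm r e) z (proj₂ (unit r) z m))

  lift-comm-⊆ : (X Y : Subset R) → lift _∘_ X Y ⊆ lift _∘_ Y X
  lift-comm-⊆ X Y z (x , y , x∈X , y∈Y , z∈xy) =
    y , x , y∈Y , x∈X , proj₁ (comm x y) z z∈xy

  lift-comm : (X Y : Subset R) → lift _∘_ X Y ≐ lift _∘_ Y X
  lift-comm X Y = lift-comm-⊆ X Y , lift-comm-⊆ Y X

  lift-assoc-⊆ : (X Y Z : Subset R) →
    lift _∘_ X (lift _∘_ Y Z) ⊆ lift _∘_ (lift _∘_ X Y) Z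
  lift-assoc-⊆ X Y Z z (x , w , x∈X , (y , z' , y∈Y , z'∈Z , w∈yz') , z∈xw)
    with proj₁ (assoc x y z') z (x , w , refl , w∈yz' , z∈xw)
  ... | u , _ , u∈xy , refl , z∈uz' =
    u , z' , (x , y , x∈X , y∈Y , u∈xy) , z'∈Z , z∈uz'

  lift-assoc-⊇ : (X Y Z : Subset R) →
    lift _∘_ (lift _∘_ X Y) Z ⊆ lift _∘_ X (lift _∘_ Y Z)
  lift-assoc-⊇ X Y Z z (w , z' , (x , y , x∈X , y∈Y , w∈xy) , z'∈Z , z∈wz')
    with proj₂ (assoc x y z') z (w , z' , w∈xy , refl , z∈wz')
  ... | _ , v , refl , v∈yz' , z∈xv =
    x , v , x∈X , (y , z' , y∈Y , z'∈Z , v∈yz') , z∈xv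

  lift-assoc : (X Y Z : Subset R) →
    lift _∘_ X (lift _∘_ Y Z) ≐ lift _∘_ (lift _∘_ X Y) Z
  lift-assoc X Y Z = lift-assoc-⊆ X Y Z , lift-assoc-⊇ X Y Z

  lift-unitˡ : (X : Subset R) → lift _∘_ ⟦ e ⟧ X ≐ X
  lift-unitˡ X =
      (λ { z (_ , x , refl , x∈X , z∈ex) →
             subst X (sym (proj₁ (unitˡ x) z z∈ex)) x∈X })
    , (λ z z∈X → e , z , refl , z∈X , proj₂ (unitˡ z) z refl)

module CBILaws {ℓ} (M : CBIModel ℓ) where
  open CBIModel M

  -- Negation is an involution: ∞ ∈ (-x) ∘ x, so x is the inverse of -x.
  neg-involutive : ∀ x → - (- x) ≡ x
  neg-involutive x =
    sym (inv-unique (- x) x (proj₁ (comm x (- x)) ∞ (inv-mem x)))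

  neg-is-wand : (X : Subset R) → image -_ X ≐ wand _∘_ X ⟦ ∞ ⟧
  neg-is-wand X =
      (λ { z (x , x∈X , refl) → x , ∞ , x∈X , refl , inv-mem x })
    , (λ { z (x , _ , x∈X , refl , ∞∈xz) → x , x∈X , inv-unique x z ∞∈xz })

  neg-neg : (X : Subset R) → image -_ (image -_ X) ≐ X
  neg-neg X =
      (λ { z (_ , (x , x∈X , refl) , refl) →
             subst X (sym (neg-involutive x)) x∈X })
    , (λ z z∈X → - z , (z , z∈X , refl) , sym (neg-involutive z))

lemma4p2p1 : ∀ {ℓ} (M : CBIModel ℓ) → let open CBIModel M in
    (X Y Z : Subset R) →
      ((lift _∘_ X Y ≐ lift _∘_ Y X)
        × (lift _∘_ X (lift _∘_ Y Z) ≐ lift _∘_ (lift _∘_ X Y) Z)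
        × (lift _∘_ ⟦ e ⟧ X ≐ X))
      × (image -_ X ≐ wand _∘_ X ⟦ ∞ ⟧)
      × (image -_ (image -_ X) ≐ X)
lemma4p2p1 M X Y Z =
    (lift-comm X Y , lift-assoc X Y Z , lift-unitˡ X)
  , neg-is-wand X
  , neg-neg X
  where
  open BBILaws (CBIModel.bbi M)
  open CBILaws M
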